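{- Let $k\ge4$ and let $(p_i)_{i\ge3}$ be a sequence of integers with $p_i>1$ for all $3\le i\le k$. Let $(k_j)_{j\ge1}$ be the sequence of positive integers defined by $k_1=1$ and $k_j=\min\{l>k_{j-1} \mid u^k_l=u^{k-1}_j\}$ for $j\ge2$. Then for every $j\ge1$ and every integer $n$ such that $k_j<n<k_{j+1}$, we have $u^k_n=p_k\cdot u^k_{n-j}$.
   Context: For $m\ge 3$, $(u^m_j)_{j\ge1}$ denotes the list, in nondecreasing order and counted with multiplicity over the exponent tuples $(\alpha_3,\dots,\alpha_m)\in\mathbb{Z}_{\ge0}^{m-2}$, of the numbers $\prod_{i=3}^m p_i^{\alpha_i}$ (e.g. for $(p_3,p_4)=(2,3)$, $(u^4_j)$ begins $1,2,3,4,6,8,9,\dots$). -}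

module Defs where

open import Data.Nat using (ℕ; zero; suc; _+_; _*_; _∸_; _^_; _≤_; _<_)
open import Data.Vec using (Vec; []; _∷_)
open import Data.Product using (Σ; _×_)
open import Relation.Binary.PropositionalEquality using (_≡_)
open import Function.Definitions using (Bijective)

prodFrom : (ℕ → ℕ) → ℕ → {n : ℕ} → Vec ℕ n → ℕ
prodFrom p s []      = 1
prodFrom p s (a ∷ α) = p s ^ a * prodFrom p (suc s) α

tupleProd : (ℕ → ℕ) → {n : ℕ} → Vec ℕ n → ℕ
tupleProd p α = prodFrom p 3 α

-- IsU p m v : v (indexed from 1; v 0 is irrelevant) is the list, in
-- nondecreasing order and counted with multiplicity over the exponent tuples
-- (α_3,…,α_m) ∈ ℕ^{m-2}, of the numbers ∏_{i=3}^m p_i^{α_i}.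
IsU : (ℕ → ℕ) → ℕ → (ℕ → ℕ) → Set
IsU p m v =
  Σ (ℕ → Vec ℕ (m ∸ 2)) λ e →
    Bijective _≡_ _≡_ e
    × (∀ j → v (suc j) ≡ tupleProd p (e j))
    × (∀ j → v (suc j) ≤ v (suc (suc j)))

IsKSeq : (ℕ → ℕ) → (ℕ → ℕ) → (ℕ → ℕ) → Set
IsKSeq uk uk1 kk =
  (kk 1 ≡ 1)
  × (∀ j → 2 ≤ j →
       (kk (j ∸ 1) < kk j)
       × (uk (kk j) ≡ uk1 j)
       × (∀ l → kk (j ∸ 1) < l → uk l ≡ uk1 j → kk j ≤ l))

module Submission where

-- Idea of the proof.  Index the lists from 0: U i = u^k_{i+1}, A i = u^{k-1}_{i+1},
-- K i = k_{i+1} - 1, and q = p_k.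
--
-- (1) Splitting an exponent tuple (α_3,…,α_k) according to whether α_k = 0 or
--     α_k > 0 shows that the values of U, counted with multiplicity, are
--     exactly the values of A together with the values of q·U
--     ('lastExponent-union', transported to the lists by 'listing-union').
-- (2) Hence for every downward-closed set of values P (a threshold "≤ v" or
--     "< v") the numbers b, a, c of positions of U, A, q·U with value in P
--     satisfy b = a + c ('segment-union', proved by a pigeonhole argument).
-- (3) Since U (K i) = A i and K is strictly increasing, K i < b holds exactly
--     for i < a; when K j < n < K (j+1) this pins c = b - a down relative to
--     n - j ('interlace-above', 'interlace-below').
-- (4) Taking v = U n and the thresholds "≤ v" and "< v" gives
--     q·U (n-j-1) ≤ U n and U n ≤ q·U (n-j-1) ('Interlacing.theorem').

open import Defs
open import Data.Nat using (ℕ; zero; suc; _+_; _*_; _∸_; _^_; _≤_; _<_; _≤?_; _<?_; z≤n; s≤s)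
open import Data.Nat.Properties
open import Data.Fin using (toℕ; fromℕ<)
open import Data.Fin.Properties using (toℕ<n; toℕ-injective; fromℕ<-injective; injective⇒≤)
open import Data.Product using (Σ; ∃; ∃₂; _×_; _,_; proj₁; proj₂)
open import Data.Sum using (_⊎_; inj₁; inj₂; [_,_]′)
open import Data.Sum.Function.Propositional using (_⊎-↔_)
open import Data.Vec using (Vec; []; _∷_; _∷ʳ_; init; last; initLast; replicate)
open import Data.Vec.Properties using (init-∷ʳ; last-∷ʳ)
open import Data.Empty using (⊥-elim)
open import Function using (_∘_; id)
open import Function.Bundles using (Inverse; _↔_; mk⤖; mk↔ₛ′)
open import Function.Properties.Inverse using (↔-trans; ↔-sym)
open import Function.Properties.Bijection using (⤖⇒↔)
open import Relation.Nullary using (¬_; yes; no)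
open import Relation.Unary using (Decidable)
open import Relation.Binary.PropositionalEquality
  using (_≡_; refl; sym; trans; cong; cong₂; subst; subst₂; module ≡-Reasoning)

Nondecreasing : (ℕ → ℕ) → Set
Nondecreasing f = ∀ i → f i ≤ f (suc i)

StrictlyIncreasing : (ℕ → ℕ) → Set
StrictlyIncreasing f = ∀ i → f i < f (suc i)

Unbounded : (ℕ → ℕ) → Set
Unbounded f = ∀ x → ∃ λ M → x < f M

nondecreasing⇒monotone : ∀ {f} → Nondecreasing f → ∀ {i i'} → i ≤ i' → f i ≤ f i'
nondecreasing⇒monotone f↑ {i' = zero}   z≤n = ≤-refl
nondecreasing⇒monotone f↑ {i} {suc i'} i≤1+i' with m≤n⇒m<n∨m≡n i≤1+i'
... | inj₁ i<1+i' = ≤-trans (nondecreasing⇒monotone f↑ (≤-pred i<1+i')) (f↑ i')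
... | inj₂ refl   = ≤-refl

strictlyIncreasing-gap : ∀ {K} → StrictlyIncreasing K → ∀ i d → K i + d ≤ K (i + d)
strictlyIncreasing-gap {K} K↑ i zero =
  ≤-reflexive (trans (+-identityʳ (K i)) (cong K (sym (+-identityʳ i))))
strictlyIncreasing-gap {K} K↑ i (suc d) = begin
  K i + suc d      ≡⟨ +-suc (K i) d ⟩
  suc (K i + d)    ≤⟨ s≤s (strictlyIncreasing-gap K↑ i d) ⟩
  suc (K (i + d))  ≤⟨ K↑ (i + d) ⟩
  K (suc (i + d))  ≡⟨ cong K (sym (+-suc i d)) ⟩
  K (i + suc d)    ∎
  where open ≤-Reasoning

strictlyIncreasing⇒inflationary : ∀ {K} → StrictlyIncreasing K → ∀ i → i ≤ K i
strictlyIncreasing⇒inflationary {K} K↑ i =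
  ≤-trans (m≤n+m i (K 0)) (strictlyIncreasing-gap K↑ 0 i)

Segment : (ℕ → Set) → ℕ → Set
Segment Q r = ∀ i → (Q i → i < r) × (i < r → Q i)

DownwardClosed : (ℕ → Set) → Set
DownwardClosed Q = ∀ {x y} → x ≤ y → Q y → Q x

segment-exists : ∀ {Q} → Decidable Q → DownwardClosed Q → ∀ M → ¬ Q M → ∃ (Segment Q)
segment-exists Q? Q↓ zero ¬Q0 = 0 , λ i → (λ Qi → ⊥-elim (¬Q0 (Q↓ z≤n Qi))) , λ ()
segment-exists {Q} Q? Q↓ (suc M) ¬Q[1+M] with Q? M
... | no ¬QM = segment-exists Q? Q↓ M ¬QM
... | yes QM = suc M , λ i → below i , λ i<1+M → Q↓ (≤-pred i<1+M) QM
  where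
  below : ∀ i → Q i → i < suc M
  below i Qi with i ≤? M
  ... | yes i≤M = s≤s i≤M
  ... | no i≰M  = ⊥-elim (¬Q[1+M] (Q↓ (≰⇒> i≰M) Qi))

threshold-segment : ∀ {f P} → Nondecreasing f → Decidable P → DownwardClosed P
                  → ∀ M → ¬ P (f M) → ∃ (Segment (P ∘ f))
threshold-segment f↑ P? P↓ =
  segment-exists (P? ∘ _) (λ i≤i' → P↓ (nondecreasing⇒monotone f↑ i≤i'))

injection-bound : ∀ {m n} (f : ℕ → ℕ) → (∀ {i} → i < m → f i < n)
                → (∀ {i i'} → i < m → i' < m → f i ≡ f i' → i ≡ i') → m ≤ n
injection-bound f f< f-inj = injective⇒≤ {f = λ i → fromℕ< (f< (toℕ<n i))} λ {i} {i'} eq →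
  toℕ-injective (f-inj (toℕ<n i) (toℕ<n i')
                       (fromℕ<-injective _ _ (f< (toℕ<n i)) (f< (toℕ<n i')) eq))

MultisetUnion : {X Y Z : Set} → (X → ℕ) → (Y → ℕ) → (Z → ℕ) → Set
MultisetUnion {X} {Y} {Z} u a b =
  Σ (X ↔ (Y ⊎ Z)) λ σ → ∀ x → u x ≡ [ a , b ]′ (Inverse.to σ x)

reindex : ∀ {X Y Z X' Y' Z' : Set} {u : X → ℕ} {a : Y → ℕ} {b : Z → ℕ}
          {u' : X' → ℕ} {a' : Y' → ℕ} {b' : Z' → ℕ}
          (ι : X' ↔ X) (κ : Y' ↔ Y) (μ : Z' ↔ Z)
        → (∀ x → u' x ≡ u (Inverse.to ι x)) → (∀ y → a' y ≡ a (Inverse.to κ y))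
        → (∀ z → b' z ≡ b (Inverse.to μ z))
        → MultisetUnion u a b → MultisetUnion u' a' b'
reindex {Y = Y} {Z} {Y' = Y'} {Z'} {a = a} {b} {a' = a'} {b'} ι κ μ u'≡ a'≡ b'≡ (σ , u≡) =
  ↔-trans ι (↔-trans σ τ) ,
  λ x → trans (u'≡ x) (trans (u≡ (Inverse.to ι x)) (relabel (Inverse.to σ (Inverse.to ι x))))
  where
  τ : (Y ⊎ Z) ↔ (Y' ⊎ Z')
  τ = ↔-sym κ ⊎-↔ ↔-sym μ
  relabel : ∀ w → [ a , b ]′ w ≡ [ a' , b' ]′ (Inverse.to τ w)
  relabel (inj₁ y) = sym (trans (a'≡ _) (cong a (Inverse.strictlyInverseˡ κ y)))
  relabel (inj₂ z) = sym (trans (b'≡ _) (cong b (Inverse.strictlyInverseˡ μ z)))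

segment-union : ∀ {U A B : ℕ → ℕ} {P : ℕ → Set} {b a c} → MultisetUnion U A B
              → Segment (P ∘ U) b → Segment (P ∘ A) a → Segment (P ∘ B) c → b ≡ a + c
segment-union {U} {A} {B} {P} {b} {a} {c} (σ , U≡) segU segA segB =
  ≤-antisym (injection-bound (code ∘ to) to-bound to-injective)
            (injection-bound (from ∘ decode) from-bound from-injective)
  where
  open Inverse σ using (to; from; strictlyInverseˡ; strictlyInverseʳ)

  InRange : ℕ ⊎ ℕ → Set
  InRange (inj₁ y) = y < a
  InRange (inj₂ z) = z < c

  inRange : ∀ w → P ([ A , B ]′ w) → InRange w
  inRange (inj₁ y) = proj₁ (segA y)
  inRange (inj₂ z) = proj₁ (segB z)

  fromRange : ∀ w → InRange w → P ([ A , B ]′ w)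
  fromRange (inj₁ y) = proj₂ (segA y)
  fromRange (inj₂ z) = proj₂ (segB z)

  code : ℕ ⊎ ℕ → ℕ
  code = [ id , a +_ ]′

  decode : ℕ → ℕ ⊎ ℕ
  decode x with x <? a
  ... | yes _ = inj₁ x
  ... | no _  = inj₂ (x ∸ a)

  code-decode : ∀ x → code (decode x) ≡ x
  code-decode x with x <? a
  ... | yes _  = refl
  ... | no x≮a = m+[n∸m]≡n (≮⇒≥ x≮a)

  decode-code : ∀ w → InRange w → decode (code w) ≡ w
  decode-code (inj₁ y) y<a with y <? a
  ... | yes _  = refl
  ... | no y≮a = ⊥-elim (y≮a y<a)
  decode-code (inj₂ z) _ with a + z <? a
  ... | yes a+z<a = ⊥-elim (<⇒≱ a+z<a (m≤m+n a z))
  ... | no _      = cong inj₂ (m+n∸m≡n a z)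

  code-bound : ∀ w → InRange w → code w < a + c
  code-bound (inj₁ y) y<a = <-≤-trans y<a (m≤m+n a c)
  code-bound (inj₂ z) z<c = +-monoʳ-< a z<c

  decode-range : ∀ x → x < a + c → InRange (decode x)
  decode-range x x<a+c with x <? a
  ... | yes x<a = x<a
  ... | no x≮a  = +-cancelˡ-< a (x ∸ a) c
                    (subst (_< a + c) (sym (m+[n∸m]≡n (≮⇒≥ x≮a))) x<a+c)

  toRange : ∀ {i} → i < b → InRange (to i)
  toRange {i} i<b = inRange (to i) (subst P (U≡ i) (proj₂ (segU i) i<b))

  to-bound : ∀ {i} → i < b → code (to i) < a + c
  to-bound i<b = code-bound _ (toRange i<b)

  to-injective : ∀ {i i'} → i < b → i' < b → code (to i) ≡ code (to i') → i ≡ i'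
  to-injective {i} {i'} i<b i'<b eq = begin
    i                           ≡⟨ sym (strictlyInverseʳ i) ⟩
    from (to i)                 ≡⟨ cong from (sym (decode-code _ (toRange i<b))) ⟩
    from (decode (code (to i))) ≡⟨ cong (from ∘ decode) eq ⟩
    from (decode (code (to i'))) ≡⟨ cong from (decode-code _ (toRange i'<b)) ⟩
    from (to i')                ≡⟨ strictlyInverseʳ i' ⟩
    i'                          ∎
    where open ≡-Reasoning

  from-bound : ∀ {x} → x < a + c → from (decode x) < b
  from-bound {x} x<a+c = proj₁ (segU (from w)) (subst P (sym U[from-w]) (fromRange w (decode-range x x<a+c)))
    where
    w : ℕ ⊎ ℕ
    w = decode x
    U[from-w] : U (from w) ≡ [ A , B ]′ w
    U[from-w] = trans (U≡ (from w)) (cong [ A , B ]′ (strictlyInverseˡ w))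

  from-injective : ∀ {x x'} → x < a + c → x' < a + c → from (decode x) ≡ from (decode x') → x ≡ x'
  from-injective {x} {x'} _ _ eq = begin
    x                      ≡⟨ sym (code-decode x) ⟩
    code (decode x)        ≡⟨ cong code (sym (strictlyInverseˡ (decode x))) ⟩
    code (to (from (decode x)))  ≡⟨ cong (code ∘ to) eq ⟩
    code (to (from (decode x'))) ≡⟨ cong code (strictlyInverseˡ (decode x')) ⟩
    code (decode x')       ≡⟨ code-decode x' ⟩
    x'                     ∎
    where open ≡-Reasoning

x<b^x : ∀ {b} → 2 ≤ b → ∀ x → x < b ^ x
x<b^x b≥2 zero    = s≤s z≤n
x<b^x {b} b≥2 (suc x) = begin-strict
  suc x                 <⟨ +-mono-≤ (≤-trans (s≤s z≤n) bˣ>x) bˣ>x ⟩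
  b ^ x + b ^ x         ≡⟨ cong (b ^ x +_) (sym (+-identityʳ (b ^ x))) ⟩
  2 * b ^ x             ≤⟨ *-monoˡ-≤ (b ^ x) b≥2 ⟩
  b * b ^ x             ∎
  where
  open ≤-Reasoning
  bˣ>x : x < b ^ x
  bˣ>x = x<b^x b≥2 x

prod-positive : ∀ p s {n} (α : Vec ℕ n) → (∀ i → s ≤ i → i < s + n → 1 ≤ p i)
              → 1 ≤ prodFrom p s α
prod-positive p s []      _      = ≤-refl
prod-positive p s {suc n} (e ∷ α) p≥1 = *-mono-≤ pow≥1 (prod-positive p (suc s) α p'≥1)
  where
  pow≥1 : 1 ≤ p s ^ e
  pow≥1 = subst (_≤ p s ^ e) (^-zeroˡ e)
            (^-monoˡ-≤ e (p≥1 s ≤-refl (subst (s <_) (sym (+-suc s n)) (s≤s (m≤m+n s n)))))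
  p'≥1 : ∀ i → suc s ≤ i → i < suc s + n → 1 ≤ p i
  p'≥1 i s<i i<s+1+n = p≥1 i (<⇒≤ s<i) (subst (i <_) (sym (+-suc s n)) i<s+1+n)

prod-zeros : ∀ p s n → prodFrom p s (replicate n 0) ≡ 1
prod-zeros p s zero    = refl
prod-zeros p s (suc n) = trans (+-identityʳ _) (prod-zeros p (suc s) n)

prod-snoc : ∀ p s {n} (α : Vec ℕ n) e → prodFrom p s (α ∷ʳ e) ≡ prodFrom p s α * p (s + n) ^ e
prod-snoc p s [] e = begin
  p s ^ e * 1       ≡⟨ *-identityʳ _ ⟩
  p s ^ e           ≡⟨ cong (λ t → p t ^ e) (sym (+-identityʳ s)) ⟩
  p (s + 0) ^ e     ≡⟨ sym (*-identityˡ _) ⟩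
  1 * p (s + 0) ^ e ∎
  where open ≡-Reasoning
prod-snoc p s {suc n} (e' ∷ α) e = begin
  p s ^ e' * prodFrom p (suc s) (α ∷ʳ e)            ≡⟨ cong (p s ^ e' *_) (prod-snoc p (suc s) α e) ⟩
  p s ^ e' * (prodFrom p (suc s) α * p (suc s + n) ^ e) ≡⟨ sym (*-assoc (p s ^ e') _ _) ⟩
  p s ^ e' * prodFrom p (suc s) α * p (suc s + n) ^ e   ≡⟨ cong (λ t → p s ^ e' * prodFrom p (suc s) α * p t ^ e) (sym (+-suc s n)) ⟩
  p s ^ e' * prodFrom p (suc s) α * p (s + suc n) ^ e   ∎
  where open ≡-Reasoning

decrementLast : ∀ {n} → Vec ℕ n → ℕ → Vec ℕ n ⊎ Vec ℕ (suc n)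
decrementLast α zero    = inj₁ α
decrementLast α (suc e) = inj₂ (α ∷ʳ e)

lastSplit : ∀ {n} → Vec ℕ (suc n) → Vec ℕ n ⊎ Vec ℕ (suc n)
lastSplit t = decrementLast (init t) (last t)

lastMerge : ∀ {n} → Vec ℕ n ⊎ Vec ℕ (suc n) → Vec ℕ (suc n)
lastMerge (inj₁ α) = α ∷ʳ 0
lastMerge (inj₂ t) = init t ∷ʳ suc (last t)

init-∷ʳ-last : ∀ {n} (t : Vec ℕ (suc n)) → init t ∷ʳ last t ≡ t
init-∷ʳ-last t = sym (proj₂ (proj₂ (initLast t)))

lastMerge-lastSplit : ∀ {n} (t : Vec ℕ (suc n)) → lastMerge (lastSplit t) ≡ t
lastMerge-lastSplit t = trans (merge-decrement (init t) (last t)) (init-∷ʳ-last t)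
  where
  merge-decrement : ∀ {n} (α : Vec ℕ n) e → lastMerge (decrementLast α e) ≡ α ∷ʳ e
  merge-decrement α zero    = refl
  merge-decrement α (suc e) = cong₂ _∷ʳ_ (init-∷ʳ e α) (cong suc (last-∷ʳ e α))

lastSplit-lastMerge : ∀ {n} (w : Vec ℕ n ⊎ Vec ℕ (suc n)) → lastSplit (lastMerge w) ≡ w
lastSplit-lastMerge (inj₁ α) = cong₂ decrementLast (init-∷ʳ 0 α) (last-∷ʳ 0 α)
lastSplit-lastMerge (inj₂ t) =
  trans (cong₂ decrementLast (init-∷ʳ _ (init t)) (last-∷ʳ _ (init t)))
        (cong inj₂ (init-∷ʳ-last t))

lastExponent↔ : ∀ {n} → Vec ℕ (suc n) ↔ (Vec ℕ n ⊎ Vec ℕ (suc n))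
lastExponent↔ = mk↔ₛ′ lastSplit lastMerge lastSplit-lastMerge lastMerge-lastSplit

lastExponent-union : ∀ p s n → MultisetUnion (prodFrom p s {suc n}) (prodFrom p s {n})
                                             (λ t → p (s + n) * prodFrom p s t)
lastExponent-union p s n =
  lastExponent↔ , λ t → trans (cong (prodFrom p s) (sym (lastMerge-lastSplit t)))
                              (prod-lastMerge (lastSplit t))
  where
  q : ℕ
  q = p (s + n)
  prod-lastMerge : ∀ w → prodFrom p s (lastMerge w) ≡ [ prodFrom p s , (λ t → q * prodFrom p s t) ]′ w
  prod-lastMerge (inj₁ α) = trans (prod-snoc p s α 0) (*-identityʳ _)
  prod-lastMerge (inj₂ t) = begin
    prodFrom p s (init t ∷ʳ suc (last t))  ≡⟨ prod-snoc p s (init t) (suc (last t)) ⟩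
    P * (q * Q)                            ≡⟨ sym (*-assoc P q Q) ⟩
    P * q * Q                              ≡⟨ cong (_* Q) (*-comm P q) ⟩
    q * P * Q                              ≡⟨ *-assoc q P Q ⟩
    q * (P * Q)                            ≡⟨ cong (q *_) (sym (prod-snoc p s (init t) (last t))) ⟩
    q * prodFrom p s (init t ∷ʳ last t)    ≡⟨ cong (λ t' → q * prodFrom p s t') (init-∷ʳ-last t) ⟩
    q * prodFrom p s t                     ∎
    where
    open ≡-Reasoning
    P Q : ℕ
    P = prodFrom p s (init t)
    Q = q ^ last t

listing-nondecreasing : ∀ {p m v} → IsU p m v → Nondecreasing (v ∘ suc)
listing-nondecreasing (_ , _ , _ , v↑) = v↑

listing↔ : ∀ p m v → IsU p m v → ℕ ↔ Vec ℕ (m ∸ 2)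
listing↔ _ _ _ (_ , bij , _) = ⤖⇒↔ (mk⤖ bij)

listing-union : ∀ {p n v w} → IsU p (3 + n) v → IsU p (2 + n) w
              → MultisetUnion (v ∘ suc) (w ∘ suc) (λ i → p (3 + n) * v (suc i))
listing-union {p} {n} {v} {w} hv@(_ , _ , v≡ , _) hw@(_ , _ , w≡ , _) =
  reindex (listing↔ p (3 + n) v hv) (listing↔ p (2 + n) w hw) (listing↔ p (3 + n) v hv) v≡ w≡ (λ i → cong (p (3 + n) *_) (v≡ i))
          (lastExponent-union p 3 n)

-- u^m is unbounded (m ≥ 3): the tuple (x, 0, …, 0) has product p_3^x > x.
listing-unbounded : ∀ {p n v} → IsU p (3 + n) v → 2 ≤ p 3 → Unbounded (v ∘ suc)
listing-unbounded {p} {n} {v} hv@(_ , _ , v≡ , _) p₃≥2 x = from t , subst (x <_) (sym v[from-t]) x<prod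
  where
  open Inverse (listing↔ p (3 + n) v hv) using (from; strictlyInverseˡ)
  t : Vec ℕ (suc n)
  t = x ∷ replicate n 0
  v[from-t] : v (suc (from t)) ≡ prodFrom p 3 t
  v[from-t] = trans (v≡ (from t)) (cong (prodFrom p 3) (strictlyInverseˡ t))
  x<prod : x < prodFrom p 3 t
  x<prod = subst (λ y → x < p 3 ^ x * y) (sym (prod-zeros p 4 n))
             (subst (x <_) (sym (*-identityʳ _)) (x<b^x p₃≥2 x))

listing-starts-at-one : ∀ {p m v} → IsU p m v → (∀ i → 3 ≤ i → i < 3 + (m ∸ 2) → 1 ≤ p i) → v 1 ≡ 1
listing-starts-at-one {p} {m} {v} hv@(e , _ , v≡ , v↑) p≥1 = ≤-antisym v₁≤1 v₁≥1
  where
  open Inverse (listing↔ p m v hv) using (from; strictlyInverseˡ)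
  zeros : Vec ℕ (m ∸ 2)
  zeros = replicate (m ∸ 2) 0
  v₁≤1 : v 1 ≤ 1
  v₁≤1 = ≤-trans (nondecreasing⇒monotone v↑ (z≤n {from zeros}))
           (≤-reflexive (trans (v≡ (from zeros))
             (trans (cong (prodFrom p 3) (strictlyInverseˡ zeros)) (prod-zeros p 3 (m ∸ 2)))))
  v₁≥1 : 1 ≤ v 1
  v₁≥1 = subst (1 ≤_) (sym (v≡ 0)) (prod-positive p 3 (e 0) p≥1)

-- If position n lies below a + c,
-- then c ≥ n - j: the a - (j+1) values of K beyond K j all lie in (n, a + c).
interlace-above : ∀ {K j n a c} → StrictlyIncreasing K → K j < n → n < K (suc j)
                → Segment (λ i → K i < a + c) a → n < a + c → n ≤ j + c
interlace-above {K} {j} {n} {a} {c} K↑ Kj<n n<K seg n<a+c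
  with m≤n⇒∃[o]m+o≡n (proj₁ (seg j) (<-trans Kj<n n<a+c))
... | zero , refl = ≤-pred (subst (λ x → n < x + c) (+-identityʳ (suc j)) n<a+c)
... | suc d , refl = ≤-pred (+-cancelʳ-< (suc d) n (suc j + c) (begin-strict
  n + suc d                 ≡⟨ +-suc n d ⟩
  suc n + d                 ≤⟨ +-monoˡ-≤ d n<K ⟩
  K (suc j) + d             ≤⟨ strictlyIncreasing-gap K↑ (suc j) d ⟩
  K (suc j + d)             <⟨ proj₂ (seg (suc j + d)) (+-monoʳ-< (suc j) (n<1+n d)) ⟩
  suc j + suc d + c         ≡⟨ +-assoc (suc j) (suc d) c ⟩
  suc j + (suc d + c)       ≡⟨ cong (suc j +_) (+-comm (suc d) c) ⟩
  suc j + (c + suc d)       ≡⟨ sym (+-assoc (suc j) c (suc d)) ⟩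
  suc j + c + suc d         ∎))
  where open ≤-Reasoning

-- Dually, if a + c ≤ n then c < n - j: the j + 1 - a values K a, …, K j all
-- lie in [a + c, n).
interlace-below : ∀ {K j n a c} → StrictlyIncreasing K → K j < n → n < K (suc j)
                → Segment (λ i → K i < a + c) a → a + c ≤ n → j + c < n
interlace-below {K} {j} {n} {a} {c} K↑ Kj<n n<K seg a+c≤n with m≤n⇒∃[o]m+o≡n a≤1+j
  where
  a≤1+j : a ≤ suc j
  a≤1+j = ≮⇒≥ λ 1+j<a → <-irrefl refl (<-trans (<-≤-trans (proj₂ (seg (suc j)) 1+j<a) a+c≤n) n<K)
... | zero , a+0≡1+j = subst (_≤ n) (begin
  a + c               ≡⟨ cong (_+ c) (sym (+-identityʳ a)) ⟩
  a + 0 + c           ≡⟨ cong (_+ c) a+0≡1+j ⟩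
  suc j + c           ∎) a+c≤n
  where open ≡-Reasoning
... | suc d , a+1+d≡1+j = begin-strict
  j + c               ≡⟨ cong (_+ c) (sym a+d≡j) ⟩
  a + d + c           ≡⟨ +-assoc a d c ⟩
  a + (d + c)         ≡⟨ cong (a +_) (+-comm d c) ⟩
  a + (c + d)         ≡⟨ sym (+-assoc a c d) ⟩
  a + c + d           ≤⟨ +-monoˡ-≤ d a+c≤Ka ⟩
  K a + d             ≤⟨ strictlyIncreasing-gap K↑ a d ⟩
  K (a + d)           ≡⟨ cong K a+d≡j ⟩
  K j                 <⟨ Kj<n ⟩
  n                   ∎
  where
  open ≤-Reasoning
  a+d≡j : a + d ≡ j
  a+d≡j = suc-injective (trans (sym (+-suc a d)) a+1+d≡1+j)
  a+c≤Ka : a + c ≤ K a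
  a+c≤Ka = ≮⇒≥ λ Ka<a+c → <-irrefl refl (proj₁ (seg a) Ka<a+c)

module Interlacing {U A K : ℕ → ℕ} {q : ℕ} (1≤q : 1 ≤ q)
  (U↑ : Nondecreasing U) (A↑ : Nondecreasing A) (U-unbounded : Unbounded U)
  (union : MultisetUnion U A (λ i → q * U i))
  (K↑ : StrictlyIncreasing K) (U∘K≡A : ∀ i → U (K i) ≡ A i) where

  -- A threshold that U leaves at position M is also left there by q·U and,
  -- since K M ≥ M, by A.
  U≤qU : ∀ i → U i ≤ q * U i
  U≤qU i = ≤-trans (≤-reflexive (sym (*-identityˡ (U i)))) (*-monoˡ-≤ (U i) 1≤q)

  U≤A : ∀ i → U i ≤ A i
  U≤A i = subst (U i ≤_) (U∘K≡A i)
                (nondecreasing⇒monotone U↑ (strictlyIncreasing⇒inflationary K↑ i))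

  threshold-counts : ∀ {P} → Decidable P → DownwardClosed P → ∀ M → ¬ P (U M)
    → ∃₂ λ a c → Segment (P ∘ U) (a + c) × Segment (λ i → P (q * U i)) c
                 × Segment (λ i → K i < a + c) a
  threshold-counts {P} P? P↓ M ¬P[UM]
    with threshold-segment U↑ P? P↓ M ¬P[UM]
       | threshold-segment A↑ P? P↓ M (¬P[UM] ∘ P↓ (U≤A M))
       | threshold-segment (λ i → *-monoʳ-≤ q (U↑ i)) P? P↓ M (¬P[UM] ∘ P↓ (U≤qU M))
  ... | b , segU | a , segA | c , segB with segment-union {P = P} union segU segA segB
  ... | refl = a , c , segU , segB , segK
    where
    segK : Segment (λ i → K i < a + c) a
    segK i = (λ Ki<b → proj₁ (segA i) (subst P (U∘K≡A i) (proj₂ (segU (K i)) Ki<b)))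
           , (λ i<a → proj₁ (segU (K i)) (subst P (sym (U∘K≡A i)) (proj₂ (segA i) i<a)))

  qU-below : ∀ {j t} → K j < suc j + t → suc j + t < K (suc j) → q * U t ≤ U (suc j + t)
  qU-below {j} {t} Kj<n n<K with U-unbounded (U (suc j + t))
  ... | M , v<UM with threshold-counts (_≤? U (suc j + t)) ≤-trans M (<⇒≱ v<UM)
  ... | a , c , segU , segB , segK = proj₂ (segB t) (+-cancelˡ-≤ j (suc t) c
          (subst (_≤ j + c) (sym (+-suc j t))
            (interlace-above K↑ Kj<n n<K segK (proj₁ (segU (suc j + t)) ≤-refl))))

  qU-above : ∀ {j t} → K j < suc j + t → suc j + t < K (suc j) → U (suc j + t) ≤ q * U t
  qU-above {j} {t} Kj<n n<K with U-unbounded (U (suc j + t))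
  ... | M , v<UM with threshold-counts (_<? U (suc j + t)) ≤-<-trans M (<-asym v<UM)
  ... | a , c , segU , segB , segK = ≮⇒≥ λ qUt<v → <⇒≱ (proj₁ (segB t) qUt<v) c≤t
    where
    n≮a+c : ¬ (suc j + t < a + c)
    n≮a+c n<a+c = <-irrefl refl (proj₂ (segU (suc j + t)) n<a+c)
    c≤t : c ≤ t
    c≤t = +-cancelˡ-≤ j c t (≤-pred (interlace-below K↑ Kj<n n<K segK (≮⇒≥ n≮a+c)))

  theorem : ∀ {j n} → K j < n → n < K (suc j) → U n ≡ q * U (n ∸ suc j)
  theorem {j} Kj<n n<K
    with m≤n⇒∃[o]m+o≡n (≤-<-trans (strictlyIncreasing⇒inflationary K↑ j) Kj<n)
  ... | t , refl rewrite m+n∸m≡n (suc j) t = ≤-antisym (qU-above Kj<n n<K) (qU-below Kj<n n<K)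

shift : (ℕ → ℕ) → ℕ → ℕ
shift kk i = kk (suc i) ∸ 1

-- Consequences of IsKSeq: k_1 = 1 and (k_j) is strictly increasing with
-- u^k_{k_j} = u^{k-1}_j.
module KSequence {uk uk1 kk : ℕ → ℕ} (kseq : IsKSeq uk uk1 kk) where

  kk-increasing : ∀ i → kk (suc i) < kk (suc (suc i))
  kk-increasing i = proj₁ (proj₂ kseq (2 + i) (s≤s (s≤s z≤n)))

  kk-positive : ∀ i → 1 ≤ kk (suc i)
  kk-positive zero    = ≤-reflexive (sym (proj₁ kseq))
  kk-positive (suc i) = ≤-trans (kk-positive i) (<⇒≤ (kk-increasing i))

  kk≡1+shift : ∀ i → kk (suc i) ≡ suc (shift kk i)
  kk≡1+shift i = sym (trans (+-comm 1 (shift kk i)) (m∸n+n≡m (kk-positive i)))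

  shift-increasing : StrictlyIncreasing (shift kk)
  shift-increasing i = ≤-pred (subst₂ _<_ (kk≡1+shift i) (kk≡1+shift (suc i)) (kk-increasing i))

  shift-hits : uk 1 ≡ uk1 1 → ∀ i → uk (suc (shift kk i)) ≡ uk1 (suc i)
  shift-hits first i = trans (cong uk (sym (kk≡1+shift i))) (hits i)
    where
    hits : ∀ i → uk (kk (suc i)) ≡ uk1 (suc i)
    hits zero    = trans (cong uk (proj₁ kseq)) first
    hits (suc i) = proj₁ (proj₂ (proj₂ kseq (2 + i) (s≤s (s≤s z≤n))))

lemma1 : (k : ℕ) → 4 ≤ k → (p : ℕ → ℕ)
         → (∀ i → 3 ≤ i → i ≤ k → 2 ≤ p i)
         → (u : ℕ → ℕ → ℕ) → (∀ m → 3 ≤ m → m ≤ k → IsU p m (u m))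
         → (kk : ℕ → ℕ) → IsKSeq (u k) (u (k ∸ 1)) kk
         → ∀ j → 1 ≤ j → ∀ n → kk j < n → n < kk (suc j)
         → u k n ≡ p k * u k (n ∸ j)
lemma1 k@(suc (suc (suc (suc r)))) (s≤s (s≤s (s≤s (s≤s _)))) p p≥2 u hu kk kseq
       (suc j) _ (suc n) kk<n n<kk = begin
  u k (suc n)                  ≡⟨ theorem Kj<n n<K ⟩
  p k * u k (suc (n ∸ suc j))  ≡⟨ cong (λ i → p k * u k i) (sym (+-∸-assoc 1 j<n)) ⟩
  p k * u k (suc n ∸ suc j)    ∎
  where
  open ≡-Reasoning
  open KSequence kseq
  uᵏ : IsU p k (u k)
  uᵏ = hu k (s≤s (s≤s (s≤s z≤n))) ≤-refl
  uᵏ⁻¹ : IsU p (k ∸ 1) (u (k ∸ 1))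
  uᵏ⁻¹ = hu (k ∸ 1) (s≤s (s≤s (s≤s z≤n))) (n≤1+n _)
  p≥1 : ∀ i → 3 ≤ i → i < suc k → 1 ≤ p i
  p≥1 i 3≤i i<1+k = ≤-trans (s≤s z≤n) (p≥2 i 3≤i (≤-pred i<1+k))
  first : u k 1 ≡ u (k ∸ 1) 1
  first = trans (listing-starts-at-one {m = k} {v = u k} uᵏ p≥1)
                (sym (listing-starts-at-one {m = k ∸ 1} {v = u (k ∸ 1)} uᵏ⁻¹
                                            (λ i 3≤i i<k → p≥1 i 3≤i (m<n⇒m<1+n i<k))))
  open Interlacing (p≥1 k (s≤s (s≤s (s≤s z≤n))) ≤-refl)
         (listing-nondecreasing {p} {k} {u k} uᵏ) (listing-nondecreasing {p} {k ∸ 1} {u (k ∸ 1)} uᵏ⁻¹)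
         (listing-unbounded {v = u k} uᵏ (p≥2 3 ≤-refl (s≤s (s≤s (s≤s z≤n)))))
         (listing-union {v = u k} {w = u (k ∸ 1)} uᵏ uᵏ⁻¹)
         shift-increasing (shift-hits first)
    using (theorem)
  Kj<n : shift kk j < n
  Kj<n = ≤-pred (subst (_< suc n) (kk≡1+shift j) kk<n)
  n<K : n < shift kk (suc j)
  n<K = ≤-pred (subst (suc n <_) (kk≡1+shift (suc j)) n<kk)
  j<n : j < n
  j<n = ≤-<-trans (strictlyIncreasing⇒inflationary shift-increasing j) Kj<n
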